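{- Let $G = (V, A)$ be a directed graph with arcs listed in some fixed order $e_1, \dots, e_m$, $m = |A|$. Let $\tau$ be a fixed word of length $L$ over two symbols $x, y$, and for each arc $e = (\mathtt{a}, \mathtt{b})$ let $T_e$ be the string over $V$ obtained from $\tau$ by replacing $x$ by $\mathtt{a}$ and $y$ by $\mathtt{b}$. Let $q \ge 1$ be an integer and $S = T_{e_1}^{q+4} T_{e_2}^{q+4} \cdots T_{e_m}^{q+4}$. Fix integers $w\ge 2$, $k \ge 1$ and any total order on $V$. For each $j$, call the 3rd through $(q+2)$-th occurrences of $T_{e_j}$ in the run $T_{e_j}^{q+4}$ the middle blocks, and let $\lambda = |\mathcal{M}_{w,k}(S)| - N$, where $N$ is the number of elements of $\mathcal{M}_{w,k}(S)$ lying in middle blocks (over all arcs). If $L \ge \frac{1}{4}(w+k-1)$, then $|A| - 1 \le \lambda \le 4 \cdot |A| \cdot L$.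
   Context: Strings are 1-indexed; $X^q$ denotes the concatenation of $q$ copies of $X$. For a string $S$ of length $n$ over a totally ordered alphabet (order extended lexicographically to strings) and integers $w \ge 2$, $k \ge 1$: for each $i \in [1, n-w-k+2]$, the minimizer of the window $S[i\mathinner{.\,.} i+w+k-2]$ is the smallest position $j \in [i, i+w-1]$ such that $S[j\mathinner{.\,.} j+k-1]$ is lexicographically smallest among the fragments $S[j'\mathinner{.\,.} j'+k-1]$, $j' \in [i,i+w-1]$; $\mathcal{M}_{w,k}(S)$ is the set of all such minimizers. -}

module Defs where

open import Level using (Level)
open import Data.Bool using (Bool; true; false; _∧_; _∨_; not; if_then_else_)
open import Data.Nat using (ℕ; zero; suc; _+_; _*_; _∸_; _<ᵇ_; _≤ᵇ_; _≟_)
open import Data.List using (List; []; _∷_; map; take; drop; length; concat; replicate; upTo; filterᵇ; deduplicate)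
open import Data.Bool.ListAction using (any)
open import Data.Product using (_×_; _,_; proj₁; proj₂)
open import Relation.Binary using (Rel; IsStrictTotalOrder; tri<; tri≈; tri>)
open import Relation.Binary.PropositionalEquality using (_≡_)

data Sym : Set where
  x y : Sym

module Minimizers {V : Set} {ℓ : Level} {_<_ : Rel V ℓ}
                  (sto : IsStrictTotalOrder _≡_ _<_) where

  open IsStrictTotalOrder sto using (compare)

  lexLt : List V → List V → Bool
  lexLt [] [] = false
  lexLt [] (_ ∷ _) = true
  lexLt (_ ∷ _) [] = false
  lexLt (a ∷ as) (b ∷ bs) with compare a b
  ... | tri< _ _ _ = true
  ... | tri≈ _ _ _ = lexLt as bs
  ... | tri> _ _ _ = false

  -- 1-indexed fragment S[j .. j+k-1]
  frag : List V → ℕ → ℕ → List V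
  frag S k j = take k (drop (j ∸ 1) S)

  -- minimizer of the window S[i .. i+w+k-2]: the smallest position
  -- j ∈ [i, i+w-1] whose length-k fragment is lexicographically smallest
  -- (left-to-right scan, replacing the current best only on strict improvement)
  minimizer : List V → ℕ → ℕ → ℕ → ℕ
  minimizer S w k i = go i (w ∸ 1) (suc i)
    where
    go : ℕ → ℕ → ℕ → ℕ
    go best zero _ = best
    go best (suc r) j =
      go (if lexLt (frag S k j) (frag S k best) then j else best) r (suc j)

  -- window start positions i ∈ [1, n-w-k+2]
  windows : List V → ℕ → ℕ → List ℕ
  windows S w k = map suc (upTo ((length S + 2) ∸ (w + k)))

  𝓜 : List V → ℕ → ℕ → List ℕ
  𝓜 S w k = deduplicate _≟_ (map (minimizer S w k) (windows S w k))

subst-arc : {V : Set} → V × V → List Sym → List V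
subst-arc e τ = map f τ
  where
  f : Sym → _
  f x = proj₁ e
  f y = proj₂ e

buildS : {V : Set} → List (V × V) → List Sym → ℕ → List V
buildS A τ q = concat (map (λ e → concat (replicate (q + 4) (subst-arc e τ))) A)

-- position p (1-indexed) of S lies in a middle block, i.e. in one of the
-- 3rd..(q+2)-th copies of T_{e_j} in the j-th run (j = jj+1, jj < m):
-- jj·(q+4)L + 2L < p ≤ jj·(q+4)L + (q+2)L
inMiddle : (m L q : ℕ) → ℕ → Bool
inMiddle m L q p =
  any (λ jj → ((jj * ((q + 4) * L) + 2 * L) <ᵇ p)
             ∧ (p ≤ᵇ (jj * ((q + 4) * L) + (q + 2) * L))) (upTo m)

lambdaVal : {V : Set} {ℓ : Level} {_<_ : Rel V ℓ} →
            IsStrictTotalOrder _≡_ _<_ →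
            List (V × V) → List Sym → (q w k : ℕ) → ℕ
lambdaVal sto A τ q w k =
  length M ∸ length (filterᵇ (inMiddle (length A) (length τ) q) M)
  where
  open Minimizers sto
  M = 𝓜 (buildS A τ q) w k

-- λ counts the minimizers outside the middle blocks, i.e. distinct positions of S lying in
-- the first two or last two blocks of some run. Upper bound: a run has only 4L such positions.
-- Lower bound: for each of the first m − 1 runs, the window starting right after its middle
-- blocks spans w + k − 1 ≤ 4L characters, so its minimizer lies in the last two blocks of that
-- run or the first two of the next; these minimizers increase with the run, hence are distinct.
-- Only positions are counted.
module Submission where

open import Defs
open import Level using (Level)
open import Data.Nat using (ℕ; _+_; _*_; _∸_; _≤_)
open import Data.List using (List; length)
open import Data.List.Relation.Unary.Unique.Propositional using (Unique)
open import Data.Product using (_×_)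
open import Relation.Binary using (Rel; IsStrictTotalOrder)
open import Relation.Binary.PropositionalEquality using (_≡_)

open import Data.Bool using (true; false; T; T?; if_then_else_)
open import Data.Bool.Properties using (T-∧)
open import Data.Fin using (Fin; zero; suc)
open import Data.Fin.Properties using (injective⇒≤)
open import Data.List using ([]; _∷_; _++_; map; concat; replicate; lookup; filter; applyUpTo; upTo)
open import Data.List.Membership.Propositional using (_∈_; find; lose)
open import Data.List.Membership.Propositional.Properties
  using (∈-lookup; ∈-++⁺ˡ; ∈-++⁺ʳ; ∈-applyUpTo⁺; ∈-applyUpTo⁻; ∈-upTo⁺; ∈-upTo⁻;
         ∈-map⁺; ∈-map⁻; ∈-filter⁺; ∈-filter⁻; ∈-deduplicate⁺; ∈-deduplicate⁻)
open import Data.List.Properties using (length-++; length-map; length-applyUpTo)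
open import Data.List.Relation.Binary.Subset.Propositional using (_⊆_)
open import Data.List.Relation.Unary.All as All using ()
open import Data.List.Relation.Unary.AllPairs using (_∷_)
open import Data.List.Relation.Unary.Any using (index)
open import Data.List.Relation.Unary.Any.Properties using (any⁺; any⁻; lookup-index)
import Data.List.Relation.Unary.Unique.Propositional.Properties as Unique
open import Data.Nat using (suc; _<_; _≤?_; s≤s; s≤s⁻¹; z≤n; z<s)
open import Data.Nat.Properties
open import Data.List.Relation.Unary.Unique.DecPropositional.Properties _≟_ using (deduplicate-!)
open import Data.Nat.Tactic.RingSolver using (solve-∀)
open import Data.Product using (_,_; ∃-syntax)
open import Data.Sum using (_⊎_; inj₁; inj₂)
open import Function using (_∘_; Equivalence)
open import Relation.Nullary using (¬_; yes; no; contradiction)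
open import Relation.Unary using (Pred; Decidable)
open import Relation.Unary.Properties using (∁?)
open import Relation.Binary.PropositionalEquality using (refl; sym; trans; cong; cong₂; subst; module ≡-Reasoning)

private
  variable
    a p : Level
    A : Set a

Unique-lookup-injective : ∀ {xs : List A} → Unique xs → ∀ {i j} → lookup xs i ≡ lookup xs j → i ≡ j
Unique-lookup-injective {xs = _ ∷ _} _ {zero} {zero} _ = refl
Unique-lookup-injective (x∉xs ∷ _) {zero} {suc j} eq = contradiction eq (All.lookup x∉xs (∈-lookup j))
Unique-lookup-injective (x∉xs ∷ _) {suc i} {zero} eq = contradiction (sym eq) (All.lookup x∉xs (∈-lookup i))
Unique-lookup-injective (_ ∷ u) {suc i} {suc j} eq = cong suc (Unique-lookup-injective u eq)

Unique⇒length≤ : ∀ {xs ys : List A} → Unique xs → xs ⊆ ys → length xs ≤ length ys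
Unique⇒length≤ {xs = xs} {ys} u xs⊆ys = injective⇒≤ position-injective
  where
  position : Fin (length xs) → Fin (length ys)
  position i = index (xs⊆ys (∈-lookup i))
  position-injective : ∀ {i j} → position i ≡ position j → i ≡ j
  position-injective {i} {j} eq = Unique-lookup-injective u (begin
    lookup xs i                ≡⟨ lookup-index (xs⊆ys (∈-lookup i)) ⟩
    lookup ys (position i)     ≡⟨ cong (lookup ys) eq ⟩
    lookup ys (position j)     ≡⟨ sym (lookup-index (xs⊆ys (∈-lookup j))) ⟩
    lookup xs j                ∎)
    where open ≡-Reasoning

module _ {P : Pred A p} (P? : Decidable P) where

  length-filter+length-filter-∁ : (xs : List A) → length (filter P? xs) + length (filter (∁? P?) xs) ≡ length xs
  length-filter+length-filter-∁ [] = refl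
  length-filter+length-filter-∁ (z ∷ zs) with P? z
  ... | yes _ = cong suc (length-filter+length-filter-∁ zs)
  ... | no _ = trans (+-suc _ _) (cong suc (length-filter+length-filter-∁ zs))

  length∸length-filter : (xs : List A) → length xs ∸ length (filter P? xs) ≡ length (filter (∁? P?) xs)
  length∸length-filter xs = begin
    length xs ∸ length (filter P? xs)
      ≡⟨ cong (_∸ length (filter P? xs)) (sym (length-filter+length-filter-∁ xs)) ⟩
    length (filter P? xs) + length (filter (∁? P?) xs) ∸ length (filter P? xs)
      ≡⟨ m+n∸m≡n (length (filter P? xs)) _ ⟩
    length (filter (∁? P?) xs) ∎
    where open ≡-Reasoning

m<o∸n⇒m+n<o : ∀ {m n o} → m < o ∸ n → m + n < o
m<o∸n⇒m+n<o {m} {n} {o} m<o∸n = m≤o∸n⇒m+n≤o (suc m) (<⇒≤ n<o) m<o∸n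
  where
  n<o : n < o
  n<o = m∸n≢0⇒n<m (λ o∸n≡0 → n≮0 (subst (m <_) o∸n≡0 m<o∸n))

interval : ℕ → ℕ → List ℕ
interval a c = applyUpTo (a +_) c

length-interval : ∀ a c → length (interval a c) ≡ c
length-interval a = length-applyUpTo (a +_)

∈-interval : ∀ {a c p} → a ≤ p → p < a + c → p ∈ interval a c
∈-interval {a} {c} {p} a≤p p<a+c = subst (_∈ interval a c) (m+[n∸m]≡n a≤p) (∈-applyUpTo⁺ (a +_) p∸a<c)
  where
  p∸a<c : p ∸ a < c
  p∸a<c = +-cancelˡ-< a (p ∸ a) c (subst (_< a + c) (sym (m+[n∸m]≡n a≤p)) p<a+c)

private
  four-blocks : ∀ m L → 4 * m * L + (2 * L + 2 * L) ≡ 4 * suc m * L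
  four-blocks = solve-∀

  run-end : ∀ m q L → suc m * ((q + 4) * L) ≡ m * ((q + 4) * L) + (q + 2) * L + 2 * L
  run-end = solve-∀

  gap-end : ∀ j q L → j * ((q + 4) * L) + (q + 2) * L + 4 * L ≡ suc j * ((q + 4) * L) + 2 * L
  gap-end = solve-∀

  run-split : ∀ q L → (q + 4) * L ≡ (q + 2) * L + 2 * L
  run-split = solve-∀

  <pred⇒2+≤ : ∀ {j m} → j < m ∸ 1 → 2 + j ≤ m
  <pred⇒2+≤ {m = suc m} j<m = s≤s j<m

  m+n≤1+o⇒m≤o : ∀ {m n o} → 1 ≤ n → m + n ≤ suc o → m ≤ o
  m+n≤1+o⇒m≤o {m} {n} 1≤n m+n≤1+o = s≤s⁻¹ (≤-trans (subst (_≤ m + n) (+-comm m 1) (+-monoʳ-≤ m 1≤n)) m+n≤1+o)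

  range-widen : ∀ {j r n} → suc j ≤ n × n < suc j + r → j ≤ n × n < j + suc r
  range-widen {j} {r} {n} (j<n , n<1+j+r) = <⇒≤ j<n , subst (n <_) (sym (+-suc j r)) n<1+j+r

module MinimizerProperties {V : Set} {ℓ : Level} {_≺_ : Rel V ℓ} (sto : IsStrictTotalOrder _≡_ _≺_) where

  open Minimizers sto

  Scan : Set
  Scan = List V → ℕ → ℕ → ℕ → ℕ → ℕ → ℕ → ℕ

  ScanResult : Scan → Set
  ScanResult g = ∀ S w k i b r j → g S w k i b r j ≡ b ⊎ (j ≤ g S w k i b r j × g S w k i b r j < j + r)

  scan-result : (g : Scan) →
    (∀ S w k i b j → g S w k i b 0 j ≡ b) →
    (∀ S w k i b r j → g S w k i b (suc r) j ≡
                       g S w k i (if lexLt (frag S k j) (frag S k b) then j else b) r (suc j)) →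
    ScanResult g
  scan-result g g-zero g-suc S w k i b 0 j = inj₁ (g-zero S w k i b j)
  scan-result g g-zero g-suc S w k i b (suc r) j
    rewrite g-suc S w k i b r j with lexLt (frag S k j) (frag S k b)
  ... | true with scan-result g g-zero g-suc S w k i j r (suc j)
  ...   | inj₁ n≡j = inj₂ (≤-reflexive (sym n≡j) , subst (_< j + suc r) (sym n≡j) (m<m+n j z<s))
  ...   | inj₂ in-rest = inj₂ (range-widen in-rest)
  scan-result g g-zero g-suc S w k i b (suc r) j | false
    with scan-result g g-zero g-suc S w k i b r (suc j)
  ...   | inj₁ n≡b = inj₁ n≡b
  ...   | inj₂ in-rest = inj₂ (range-widen in-rest)

  bestOfTwo : List V → ℕ → ℕ → ℕ
  bestOfTwo S k i = if lexLt (frag S k (suc i)) (frag S k i) then suc i else i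

  bestOfTwo-bounds : ∀ S k i → i ≤ bestOfTwo S k i × bestOfTwo S k i ≤ suc i
  bestOfTwo-bounds S k i with lexLt (frag S k (suc i)) (frag S k i)
  ... | true = n≤1+n i , ≤-refl
  ... | false = ≤-refl , n≤1+n i

  -- The scan `go` is local to `minimizer` and cannot be named. The metavariable in the type
  -- of `window` is solved to it by unification at `scan S w k i b r j`, which is a pattern
  -- only because all its arguments are distinct variables: hence the first scan step and
  -- `2 + i` are abstracted (at the initial call the window start i occurs twice).
  minimizer-window : ∀ S w k i → 1 ≤ w → i ≤ minimizer S w k i × minimizer S w k i < i + w
  minimizer-window = window (scan-result _ (λ _ _ _ _ _ _ → refl) (λ _ _ _ _ _ _ _ → refl))
    where
    window : ScanResult _ → ∀ S w k i → 1 ≤ w → i ≤ minimizer S w k i × minimizer S w k i < i + w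
    window scan S w k i 1≤w with w ∸ 1 in w∸1≡1+r
    ... | 0 = ≤-refl , m<m+n i 1≤w
    ... | suc r with bestOfTwo S k i | bestOfTwo-bounds S k i
    ... | b | i≤b , b≤1+i with 2 + i in 2+i≡j
    ... | j = within (scan S w k i b r j)
      where
      i+w≡2+i+r : i + w ≡ 2 + i + r
      i+w≡2+i+r = begin
        i + w            ≡⟨ cong (i +_) (sym (m∸n+n≡m 1≤w)) ⟩
        i + (w ∸ 1 + 1)  ≡⟨ cong (λ v → i + (v + 1)) w∸1≡1+r ⟩
        i + (suc r + 1)  ≡⟨ cong (i +_) (+-comm (suc r) 1) ⟩
        i + (2 + r)      ≡⟨ trans (+-suc i (suc r)) (cong suc (+-suc i r)) ⟩
        2 + i + r        ∎
        where open ≡-Reasoning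
      within : ∀ {n} → n ≡ b ⊎ (j ≤ n × n < j + r) → i ≤ n × n < i + w
      within (inj₁ refl) = i≤b , subst (b <_) (sym i+w≡2+i+r) (s≤s (≤-trans b≤1+i (s≤s (m≤m+n i r))))
      within {n} (inj₂ (j≤n , n<j+r)) =
        ≤-trans (m≤n+m i 2) (subst (_≤ n) (sym 2+i≡j) j≤n) ,
        subst (n <_) (trans (cong (_+ r) (sym 2+i≡j)) (sym i+w≡2+i+r)) n<j+r

  ∈-𝓜⇒bounded : ∀ {S w k z} → 1 ≤ w → 1 ≤ k → z ∈ 𝓜 S w k → 1 ≤ z × z ≤ length S
  ∈-𝓜⇒bounded {S} {w} {k} 1≤w 1≤k z∈𝓜
    with i , i∈ , refl ← ∈-map⁻ (minimizer S w k) (∈-deduplicate⁻ _≟_ _ z∈𝓜)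
    with t , t∈ , refl ← ∈-map⁻ suc i∈
    with t<z , z<1+t+w ← minimizer-window S w k (suc t) 1≤w
    = ≤-trans (s≤s z≤n) t<z , ≤-trans (s≤s⁻¹ z<1+t+w) (+-cancelʳ-≤ 2 (t + w) (length S) t+w+2≤n+2)
    where
    open ≤-Reasoning
    t+w+2≤n+2 : t + w + 2 ≤ length S + 2
    t+w+2≤n+2 = begin
      t + w + 2       ≡⟨ +-assoc t w 2 ⟩
      t + (w + 2)     ≤⟨ +-monoʳ-≤ t (+-monoʳ-≤ w (s≤s 1≤k)) ⟩
      t + (w + suc k) ≡⟨ trans (cong (t +_) (+-suc w k)) (+-suc t (w + k)) ⟩
      suc (t + (w + k)) ≤⟨ m<o∸n⇒m+n<o (∈-upTo⁻ t∈) ⟩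
      length S + 2    ∎

  minimizer-∈-𝓜 : ∀ {S w k t} → suc t + (w + k) ≤ length S + 2 → minimizer S w k (suc t) ∈ 𝓜 S w k
  minimizer-∈-𝓜 {S} {w} {k} {t} bounded =
    ∈-deduplicate⁺ _≟_ (∈-map⁺ (minimizer S w k) (∈-map⁺ suc (∈-upTo⁺ (m+n≤o⇒m≤o∸n (suc t) bounded))))

  𝓜-unique : ∀ S w k → Unique (𝓜 S w k)
  𝓜-unique S w k = deduplicate-! (map (minimizer S w k) (windows S w k))

module RunLayout (L q : ℕ) where

  run : ℕ
  run = (q + 4) * L

  InMiddle : ℕ → ℕ → Set
  InMiddle j p = j * run + 2 * L < p × p ≤ j * run + (q + 2) * L

  InGap : ℕ → ℕ → Set
  InGap j p = j * run + (q + 2) * L < p × p ≤ suc j * run + 2 * L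

  inMiddle⇒InMiddle : ∀ {m p} → T (inMiddle m L q p) → ∃[ j ] j < m × InMiddle j p
  inMiddle⇒InMiddle {m} {p} h with j , j∈ , both ← find (any⁻ _ (upTo m) h)
    with lower , upper ← Equivalence.to T-∧ both
    = j , ∈-upTo⁻ j∈ , <ᵇ⇒< _ _ lower , ≤ᵇ⇒≤ _ _ upper

  InMiddle⇒inMiddle : ∀ {m j p} → j < m → InMiddle j p → T (inMiddle m L q p)
  InMiddle⇒inMiddle j<m (lower , upper) =
    any⁺ _ (lose (∈-upTo⁺ j<m) (Equivalence.from T-∧ (<⇒<ᵇ lower , ≤⇒≤ᵇ upper)))

  2L≤middleEnd : 2 * L ≤ (q + 2) * L
  2L≤middleEnd = *-monoˡ-≤ L (m≤n+m 2 q)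

  InGap⇒¬InMiddle : ∀ {j j′ p} → InGap j p → ¬ InMiddle j′ p
  InGap⇒¬InMiddle {j} {j′} (after , before) (after′ , before′) with j′ ≤? j
  ... | yes j′≤j = <⇒≱ (≤-<-trans (+-monoˡ-≤ _ (*-monoˡ-≤ run j′≤j)) after) before′
  ... | no j′≰j = <⇒≱ after′ (≤-trans before (+-monoˡ-≤ _ (*-monoˡ-≤ run (≰⇒> j′≰j))))

  InGap-< : ∀ {j j′ p p′} → j < j′ → InGap j p → InGap j′ p′ → p < p′
  InGap-< j<j′ (_ , before) (after′ , _) =
    ≤-<-trans (≤-trans before (+-mono-≤ (*-monoˡ-≤ run j<j′) 2L≤middleEnd)) after′

  outside : ℕ → List ℕ
  outside 0 = []
  outside (suc j) = outside j ++ interval (suc (j * run)) (2 * L)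
                              ++ interval (suc (j * run + (q + 2) * L)) (2 * L)

  length-outside : ∀ m → length (outside m) ≡ 4 * m * L
  length-outside 0 = refl
  length-outside (suc m) = begin
    length (outside m ++ interval _ (2 * L) ++ interval _ (2 * L))
      ≡⟨ length-++ (outside m) ⟩
    length (outside m) + length (interval _ (2 * L) ++ interval _ (2 * L))
      ≡⟨ cong₂ _+_ (length-outside m) (length-++ (interval _ (2 * L))) ⟩
    4 * m * L + (length (interval _ (2 * L)) + length (interval _ (2 * L)))
      ≡⟨ cong (4 * m * L +_) (cong₂ _+_ (length-interval _ (2 * L)) (length-interval _ (2 * L))) ⟩
    4 * m * L + (2 * L + 2 * L)
      ≡⟨ four-blocks m L ⟩
    4 * suc m * L ∎
    where open ≡-Reasoning

  ∈-outside : ∀ m {p} → 1 ≤ p → p ≤ m * run → (∀ {j} → j < m → ¬ InMiddle j p) → p ∈ outside m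
  ∈-outside 0 1≤p p≤0 _ = contradiction (≤-trans 1≤p p≤0) λ ()
  ∈-outside (suc m) {p} 1≤p p≤run+m*run notMiddle with p ≤? m * run
  ... | yes p≤m*run = ∈-++⁺ˡ (∈-outside m 1≤p p≤m*run (notMiddle ∘ m<n⇒m<1+n))
  ... | no p≰m*run with p ≤? m * run + 2 * L
  ...   | yes inFirstBlocks = ∈-++⁺ʳ (outside m) (∈-++⁺ˡ (∈-interval (≰⇒> p≰m*run) (s≤s inFirstBlocks)))
  ...   | no p≰start = ∈-++⁺ʳ (outside m) (∈-++⁺ʳ (interval _ (2 * L)) (∈-interval afterMiddle (s≤s inLastBlocks)))
    where
    afterMiddle : m * run + (q + 2) * L < p
    afterMiddle = ≰⇒> (λ inMiddle → notMiddle ≤-refl (≰⇒> p≰start , inMiddle))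
    inLastBlocks : p ≤ m * run + (q + 2) * L + 2 * L
    inLastBlocks = subst (p ≤_) (run-end m q L) p≤run+m*run

length-concat-replicate : ∀ n (xs : List A) → length (concat (replicate n xs)) ≡ n * length xs
length-concat-replicate 0 xs = refl
length-concat-replicate (suc n) xs = trans (length-++ xs) (cong (length xs +_) (length-concat-replicate n xs))

length-buildS : ∀ {V : Set} (A : List (V × V)) τ q → length (buildS A τ q) ≡ length A * ((q + 4) * length τ)
length-buildS [] τ q = refl
length-buildS (e ∷ A) τ q = begin
  length (concat (replicate (q + 4) (subst-arc e τ)) ++ buildS A τ q)
    ≡⟨ length-++ (concat (replicate (q + 4) (subst-arc e τ))) ⟩
  length (concat (replicate (q + 4) (subst-arc e τ))) + length (buildS A τ q)
    ≡⟨ cong₂ _+_ (trans (length-concat-replicate (q + 4) (subst-arc e τ)) (cong ((q + 4) *_) (length-map _ τ)))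
                 (length-buildS A τ q) ⟩
  (q + 4) * length τ + length A * ((q + 4) * length τ) ∎
  where open ≡-Reasoning

module Bounds {V : Set} {ℓ : Level} {_≺_ : Rel V ℓ} (sto : IsStrictTotalOrder _≡_ _≺_)
              (L q m : ℕ) (S : List V) (|S|≡ : length S ≡ m * ((q + 4) * L)) (w k : ℕ) where

  open Minimizers sto
  open MinimizerProperties sto
  open RunLayout L q

  outsideMiddle? : Decidable (λ p → ¬ T (inMiddle m L q p))
  outsideMiddle? = ∁? (T? ∘ inMiddle m L q)

  outsideMinimizers : List ℕ
  outsideMinimizers = filter outsideMiddle? (𝓜 S w k)

  outsideMinimizers⊆outside : 1 ≤ w → 1 ≤ k → outsideMinimizers ⊆ outside m
  outsideMinimizers⊆outside 1≤w 1≤k z∈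
    with z∈𝓜 , notMiddle ← ∈-filter⁻ outsideMiddle? {xs = 𝓜 S w k} z∈
    with 1≤z , z≤|S| ← ∈-𝓜⇒bounded 1≤w 1≤k z∈𝓜
    = ∈-outside m 1≤z (subst (_ ≤_) |S|≡ z≤|S|) (λ j<m middle → notMiddle (InMiddle⇒inMiddle j<m middle))

  length-outsideMinimizers≤ : 1 ≤ w → 1 ≤ k → length outsideMinimizers ≤ 4 * m * L
  length-outsideMinimizers≤ 1≤w 1≤k =
    subst (length outsideMinimizers ≤_) (length-outside m)
      (Unique⇒length≤ (Unique.filter⁺ outsideMiddle? (𝓜-unique S w k)) (outsideMinimizers⊆outside 1≤w 1≤k))

  gapMinimizer : ℕ → ℕ
  gapMinimizer j = minimizer S w k (suc (j * run + (q + 2) * L))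

  gapMinimizer-InGap : 1 ≤ w → w ≤ 4 * L → ∀ j → InGap j (gapMinimizer j)
  gapMinimizer-InGap 1≤w w≤4L j
    with after , before ← minimizer-window S w k (suc (j * run + (q + 2) * L)) 1≤w
    = after , ≤-trans (s≤s⁻¹ before) (≤-trans (+-monoʳ-≤ _ w≤4L) (≤-reflexive (gap-end j q L)))

  gapMinimizer-∈ : 1 ≤ w → w ≤ 4 * L → w + k ≤ suc (4 * L) → ∀ {j} → j < m ∸ 1 →
                   gapMinimizer j ∈ outsideMinimizers
  gapMinimizer-∈ 1≤w w≤4L w+k≤1+4L {j} j<m-1 =
    ∈-filter⁺ outsideMiddle? (minimizer-∈-𝓜 {S} {w} {k} windowFits) notMiddle
    where
    notMiddle : ¬ T (inMiddle m L q (gapMinimizer j))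
    notMiddle middle with j′ , _ , inMiddle ← inMiddle⇒InMiddle {m} middle =
      InGap⇒¬InMiddle {j} {j′} (gapMinimizer-InGap 1≤w w≤4L j) inMiddle
    open ≤-Reasoning
    windowFits : suc (j * run + (q + 2) * L) + (w + k) ≤ length S + 2
    windowFits = begin
      suc (j * run + (q + 2) * L) + (w + k)   ≤⟨ +-monoʳ-≤ (suc (j * run + (q + 2) * L)) w+k≤1+4L ⟩
      suc (j * run + (q + 2) * L) + suc (4 * L) ≡⟨ +-suc _ (4 * L) ⟩
      2 + (j * run + (q + 2) * L + 4 * L)      ≡⟨ cong (2 +_) (gap-end j q L) ⟩
      2 + (suc j * run + 2 * L)                ≤⟨ +-monoʳ-≤ 2 (+-monoʳ-≤ (suc j * run) (≤-trans 2L≤middleEnd (m≤m+n _ (2 * L)))) ⟩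
      2 + (suc j * run + ((q + 2) * L + 2 * L)) ≡⟨ cong (λ x → 2 + (suc j * run + x)) (sym (run-split q L)) ⟩
      2 + (suc j * run + run)                  ≡⟨ cong (2 +_) (+-comm (suc j * run) run) ⟩
      2 + (2 + j) * run                        ≤⟨ +-monoʳ-≤ 2 (*-monoˡ-≤ run (<pred⇒2+≤ {m = m} j<m-1)) ⟩
      2 + m * run                              ≡⟨ cong (2 +_) (sym |S|≡) ⟩
      2 + length S                             ≡⟨ +-comm 2 (length S) ⟩
      length S + 2                             ∎

  length-outsideMinimizers≥ : 1 ≤ w → 1 ≤ k → w + k ≤ suc (4 * L) → m ∸ 1 ≤ length outsideMinimizers
  length-outsideMinimizers≥ 1≤w 1≤k w+k≤1+4L =
    subst (_≤ length outsideMinimizers) (length-applyUpTo gapMinimizer (m ∸ 1))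
      (Unique⇒length≤ gaps-unique gaps⊆)
    where
    w≤4L : w ≤ 4 * L
    w≤4L = m+n≤1+o⇒m≤o 1≤k w+k≤1+4L
    gaps-unique : Unique (applyUpTo gapMinimizer (m ∸ 1))
    gaps-unique = Unique.applyUpTo⁺₁ gapMinimizer (m ∸ 1)
      (λ {i} {j} i<j _ → <⇒≢ (InGap-< i<j (gapMinimizer-InGap 1≤w w≤4L i) (gapMinimizer-InGap 1≤w w≤4L j)))
    gaps⊆ : applyUpTo gapMinimizer (m ∸ 1) ⊆ outsideMinimizers
    gaps⊆ z∈ with j , j<m-1 , refl ← ∈-applyUpTo⁻ gapMinimizer z∈ = gapMinimizer-∈ 1≤w w≤4L w+k≤1+4L j<m-1

lemma6 : {V : Set} {ℓ : Level} {_<_ : Rel V ℓ} →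
           (sto : IsStrictTotalOrder _≡_ _<_) →
           (A : List (V × V)) → Unique A →
           (τ : List Sym) → (q w k : ℕ) →
           1 ≤ q → 2 ≤ w → 1 ≤ k →
           w + k ∸ 1 ≤ 4 * length τ →
           (length A ∸ 1 ≤ lambdaVal sto A τ q w k)
             × (lambdaVal sto A τ q w k ≤ 4 * length A * length τ)
lemma6 sto A _ τ q w k _ 2≤w 1≤k w+k∸1≤4L =
  subst (length A ∸ 1 ≤_) (sym λ≡) (length-outsideMinimizers≥ 1≤w 1≤k w+k≤1+4L) ,
  subst (_≤ 4 * length A * length τ) (sym λ≡) (length-outsideMinimizers≤ 1≤w 1≤k)
  where
  open Bounds sto (length τ) q (length A) (buildS A τ q) (length-buildS A τ q) w k
  λ≡ : lambdaVal sto A τ q w k ≡ length outsideMinimizers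
  λ≡ = length∸length-filter (T? ∘ inMiddle (length A) (length τ) q) (Minimizers.𝓜 sto (buildS A τ q) w k)
  1≤w : 1 ≤ w
  1≤w = <⇒≤ 2≤w
  w+k≤1+4L : w + k ≤ suc (4 * length τ)
  w+k≤1+4L = ≤-trans (m≤n+m∸n (w + k) 1) (s≤s w+k∸1≤4L)
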